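{- Let $X$ be partitioned among sites $1,\ldots,s$ as $X_1,\ldots,X_s$, let $d_x\ge 0$ be a sampling weight for each $x\in X$, and let $D_i=\sum_{x\in X_i}d_x$, $D=\sum_i D_i$. Let $\lambda>1$ and suppose $\widetilde{D_i}$ satisfy $D_i\le\widetilde{D_i}\le\lambda D_i$ for every $i$ (so in particular $\sum_j D_j\le\sum_j\widetilde{D_j}<\lambda\sum_j D_j$ when $D>0$). Consider the procedure LazySampling: with $\widetilde{D}=\sum_i\widetilde{D_i}$, pick an index $i$ with probability $\widetilde{D_i}/\widetilde{D}$; then site $i$ returns $y\in X_i$ with probability $d_y/\widetilde{D_i}$ for each $y\in X_i$, and returns $\bot$ with the remaining probability $1-D_i/\widetilde{D_i}$. Let $x$ be the output and $\mathcal{E}$ the event that the output is not $\bot$. Then $\Pr[\mathcal{E}]\ge\frac{1}{\lambda}$ and $\Pr[x=y\mid\mathcal{E}]=\frac{d_y}{D}$ for every $y\in X$. Furthermore, there exists a constant $\gamma\ge 1$ (depending on $\lambda$) such that after running LazySampling independently a total of $\gamma N$ times, it returns at least $N$ points sampled from the distribution $d_x/D$ with probability at least $0.99$.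
   Formalization: The sampling weights $d_x$, the estimates $\widetilde{D_i}$ and the parameter λ are rational. -}

module Defs where

open import Data.Nat as ℕ using (ℕ; zero; suc; _≤ᵇ_)
open import Data.Fin using (Fin; zero; suc)
open import Data.Bool using (Bool; true; false; if_then_else_)
open import Data.Maybe using (Maybe; just; nothing)
open import Data.List using (List; []; _∷_)
open import Data.Rational using (ℚ; 0ℚ; 1ℚ; _+_; _*_; _-_; _÷_; ≢-nonZero)
open import Data.Rational.Properties using (_≟_)
open import Relation.Nullary using (yes; no)

-- Total division on ℚ: q ÷? 0 = 0 (only used where the divisor is nonzero
-- or where the quotient is multiplied by a zero probability).
_÷?_ : ℚ → ℚ → ℚ
p ÷? q with q ≟ 0ℚ
... | yes _ = 0ℚ
... | no q≢0 = _÷_ p q {{≢-nonZero q≢0}}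

sumFin : (n : ℕ) → (Fin n → ℚ) → ℚ
sumFin zero    f = 0ℚ
sumFin (suc n) f = f zero + sumFin n (λ i → f (suc i))

-- Setting: X = Fin n, partitioned among sites Fin s by  site : Fin n → Fin s
-- (X_i = { x | site x ≡ i }), weights d : Fin n → ℚ.
module LazySampling {n s : ℕ} (site : Fin n → Fin s) (d : Fin n → ℚ)
                    (D̃ : Fin s → ℚ) where

  Dsite : Fin s → ℚ
  Dsite i = sumFin n (λ x → if ⌊ site x ≟F i ⌋′ then d x else 0ℚ)
    where
      open import Data.Fin using () renaming (_≟_ to _≟F_)
      open import Relation.Nullary.Decidable using () renaming (⌊_⌋ to ⌊_⌋′)

  Dtot : ℚ
  Dtot = sumFin s Dsite

  D̃tot : ℚ
  D̃tot = sumFin s D̃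

  pick : Fin s → ℚ
  pick i = D̃ i ÷? D̃tot

  -- Output of one run of LazySampling: nothing = ⊥, just y = the point y.
  -- Pr[output = y] = Pr[pick site(y)] · d_y / D̃_{site(y)}
  -- Pr[output = ⊥] = Σ_i Pr[pick i] · (1 - D_i / D̃_i)
  prOut : Maybe (Fin n) → ℚ
  prOut (just y) = pick (site y) * (d y ÷? D̃ (site y))
  prOut nothing  = sumFin s (λ i → pick i * (1ℚ - (Dsite i ÷? D̃ i)))

  prE : ℚ
  prE = sumFin n (λ y → prOut (just y))

  prCond : Fin n → ℚ
  prCond y = prOut (just y) ÷? prE

  -- Probability that m independent runs produce an outcome list satisfying P:
  -- Σ over all outcome sequences (o₁,…,o_m) of Π prOut oⱼ · [P (o₁ ∷ … ∷ o_m ∷ [])].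
  runsProb : (m : ℕ) → (List (Maybe (Fin n)) → Bool) → ℚ
  runsProb zero    P = if P [] then 1ℚ else 0ℚ
  runsProb (suc m) P =
    prOut nothing * runsProb m (λ l → P (nothing ∷ l))
    + sumFin n (λ y → prOut (just y) * runsProb m (λ l → P (just y ∷ l)))

countPoints : {n : ℕ} → List (Maybe (Fin n)) → ℕ
countPoints []             = zero
countPoints (just _ ∷ l)   = suc (countPoints l)
countPoints (nothing ∷ l)  = countPoints l

atLeast : {n : ℕ} → ℕ → List (Maybe (Fin n)) → Bool
atLeast N l = N ≤ᵇ countPoints l

{-# OPTIONS --safe #-}
module Submission where

-- Since D̃ᵢ = 0 forces Dᵢ = 0, a point y is output with probability
-- (D̃_{site y} / D̃) · (d_y / D̃_{site y}) = d_y / D̃.  Hence Pr[ℰ] = D / D̃ ≥ 1/λ and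
-- conditioning on ℰ leaves d_y / D.  For the amplification let X count the points
-- returned by m runs: Markov's inequality for 2^(-X) bounds Pr[X < N] by
-- 2^N (1 - p/2)^m with p = Pr[ℰ], and for m = γN Bernoulli's inequality makes
-- 2 (1 - p/2)^γ ≤ 2 / (1 + γp/2) ≤ 1/100.

open import Defs
open import Algebra.Bundles using (CommutativeRing)
open import Data.Bool using (Bool; true; false; if_then_else_)
open import Data.Fin as Fin using (Fin; zero; suc)
open import Data.Integer as ℤ using (+_; -[1+_])
import Data.Integer.Properties as ℤ
open import Data.List using (List; []; _∷_)
open import Data.Maybe using (Maybe; just; nothing)
open import Data.Nat as ℕ using (ℕ; zero; suc; s≤s; z≤n)
open import Data.Product using (_×_; Σ-syntax; _,_)
open import Data.Rational
open import Data.Rational.Literals using (fromℤ)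
open import Data.Rational.Properties
open import Data.Rational.Solver using (module +-*-Solver)
open import Function.Base using (_∘_)
open import Relation.Binary.PropositionalEquality
open import Relation.Nullary using (Dec; yes; no; does; contradiction)
open import Relation.Nullary.Decidable using (isYes; isYes≗does; dec-true)

open CommutativeRing +-*-commutativeRing using (semiring; commutativeSemiring)
open import Algebra.Properties.Semiring.Sum semiring
  using (sum; sum-cong-≗; sum-replicate-zero; ∑-comm; ∑-distrib-+; *-distribʳ-sum; *-distribˡ-sum)
open import Algebra.Properties.CommutativeSemiring.Exp commutativeSemiring
  using (_^_; ^-assocʳ; ^-distrib-*)
open +-*-Solver
open ≤-Reasoning

0≤1 : 0ℚ ≤ 1ℚ
0≤1 = <⇒≤ (positive⁻¹ 1ℚ)

0<⇒≢0 : ∀ {q} → 0ℚ < q → q ≢ 0ℚ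
0<⇒≢0 0<q = ≢-sym (<⇒≢ 0<q)

*-nonNeg : ∀ {p q} → 0ℚ ≤ p → 0ℚ ≤ q → 0ℚ ≤ p * q
*-nonNeg {p} {q} 0≤p 0≤q =
  nonNegative⁻¹ _ {{nonNeg*nonNeg⇒nonNeg p {{nonNegative 0≤p}} q {{nonNegative 0≤q}}}}

*-pos : ∀ {p q} → 0ℚ < p → 0ℚ < q → 0ℚ < p * q
*-pos {p} {q} 0<p 0<q = positive⁻¹ _ {{pos*pos⇒pos p {{positive 0<p}} q {{positive 0<q}}}}

p-q≤p : ∀ p {q} → 0ℚ ≤ q → p - q ≤ p
p-q≤p p {q} 0≤q = begin
  p - q    ≤⟨ +-monoʳ-≤ p (neg-antimono-≤ 0≤q) ⟩
  p + 0ℚ   ≡⟨ +-identityʳ p ⟩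
  p        ∎

p≤q⇒0≤q-p : ∀ {p q} → p ≤ q → 0ℚ ≤ q - p
p≤q⇒0≤q-p {p} {q} p≤q = begin
  0ℚ      ≡⟨ +-inverseʳ p ⟨
  p - p   ≤⟨ +-monoˡ-≤ (- p) p≤q ⟩
  q - p   ∎

sumFin-cong : ∀ n {f g : Fin n → ℚ} → f ≗ g → sumFin n f ≡ sumFin n g
sumFin-cong zero    f≗g = refl
sumFin-cong (suc n) f≗g = cong₂ _+_ (f≗g zero) (sumFin-cong n (f≗g ∘ suc))

sumFin≡sum : ∀ n (f : Fin n → ℚ) → sumFin n f ≡ sum f
sumFin≡sum zero    f = refl
sumFin≡sum (suc n) f = cong (_+_ (f zero)) (sumFin≡sum n (f ∘ suc))

sumFin-zero : ∀ n → sumFin n (λ _ → 0ℚ) ≡ 0ℚ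
sumFin-zero n = trans (sumFin≡sum n _) (sum-replicate-zero n)

sumFin-distrib-+ : ∀ n (f g : Fin n → ℚ) →
                   sumFin n (λ i → f i + g i) ≡ sumFin n f + sumFin n g
sumFin-distrib-+ n f g = begin-equality
  sumFin n (λ i → f i + g i)  ≡⟨ sumFin≡sum n _ ⟩
  sum (λ i → f i + g i)       ≡⟨ ∑-distrib-+ f g ⟩
  sum f + sum g               ≡⟨ cong₂ _+_ (sumFin≡sum n f) (sumFin≡sum n g) ⟨
  sumFin n f + sumFin n g     ∎

*-distribʳ-sumFin : ∀ n c (f : Fin n → ℚ) → sumFin n (λ i → f i * c) ≡ sumFin n f * c
*-distribʳ-sumFin n c f = begin-equality
  sumFin n (λ i → f i * c)  ≡⟨ sumFin≡sum n _ ⟩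
  sum (λ i → f i * c)       ≡⟨ *-distribʳ-sum c f ⟨
  sum f * c                 ≡⟨ cong (_* c) (sumFin≡sum n f) ⟨
  sumFin n f * c            ∎

*-distribˡ-sumFin : ∀ n c (f : Fin n → ℚ) → sumFin n (λ i → c * f i) ≡ c * sumFin n f
*-distribˡ-sumFin n c f = begin-equality
  sumFin n (λ i → c * f i)  ≡⟨ sumFin≡sum n _ ⟩
  sum (λ i → c * f i)       ≡⟨ *-distribˡ-sum c f ⟨
  c * sum f                 ≡⟨ cong (c *_) (sumFin≡sum n f) ⟨
  c * sumFin n f            ∎

sumFin-comm : ∀ m n (f : Fin m → Fin n → ℚ) →
              sumFin m (λ i → sumFin n (f i)) ≡ sumFin n (λ j → sumFin m (λ i → f i j))
sumFin-comm m n f = begin-equality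
  sumFin m (λ i → sumFin n (f i))          ≡⟨ sumFin²≡sum² m n f ⟩
  sum (λ i → sum (f i))                    ≡⟨ ∑-comm f ⟩
  sum (λ j → sum (λ i → f i j))            ≡⟨ sumFin²≡sum² n m (λ j i → f i j) ⟨
  sumFin n (λ j → sumFin m (λ i → f i j))  ∎
  where
  sumFin²≡sum² : ∀ m n (f : Fin m → Fin n → ℚ) →
                 sumFin m (λ i → sumFin n (f i)) ≡ sum (λ i → sum (f i))
  sumFin²≡sum² m n f = trans (sumFin≡sum m _) (sum-cong-≗ (λ i → sumFin≡sum n (f i)))

-- Stated with does, not with the isYes = ⌊_⌋ of Defs: does commutes definitionally
-- with the map′ through which Fin._≟_ handles suc.
sumFin-indicator : ∀ n (j : Fin n) c → sumFin n (λ i → if does (j Fin.≟ i) then c else 0ℚ) ≡ c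
sumFin-indicator (suc n) zero    c = trans (cong (_+_ c) (sumFin-zero n)) (+-identityʳ c)
sumFin-indicator (suc n) (suc j) c = trans (+-identityˡ _) (sumFin-indicator n j c)

sumFin-mono-≤ : ∀ n {f g : Fin n → ℚ} → (∀ i → f i ≤ g i) → sumFin n f ≤ sumFin n g
sumFin-mono-≤ zero    f≤g = ≤-refl
sumFin-mono-≤ (suc n) f≤g = +-mono-≤ (f≤g zero) (sumFin-mono-≤ n (f≤g ∘ suc))

sumFin-nonNeg : ∀ n {f : Fin n → ℚ} → (∀ i → 0ℚ ≤ f i) → 0ℚ ≤ sumFin n f
sumFin-nonNeg n {f} 0≤f = begin
  0ℚ                     ≡⟨ sumFin-zero n ⟨
  sumFin n (λ _ → 0ℚ)    ≤⟨ sumFin-mono-≤ n 0≤f ⟩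
  sumFin n f             ∎

term≤sumFin : ∀ n {f : Fin n → ℚ} → (∀ i → 0ℚ ≤ f i) → ∀ j → f j ≤ sumFin n f
term≤sumFin (suc n) {f} 0≤f zero = begin
  f zero                          ≡⟨ +-identityʳ (f zero) ⟨
  f zero + 0ℚ                     ≤⟨ +-monoʳ-≤ (f zero) (sumFin-nonNeg n (0≤f ∘ suc)) ⟩
  sumFin (suc n) f                ∎
term≤sumFin (suc n) {f} 0≤f (suc j) = begin
  f (suc j)                       ≤⟨ term≤sumFin n (0≤f ∘ suc) j ⟩
  sumFin n (f ∘ suc)              ≡⟨ +-identityˡ _ ⟨
  0ℚ + sumFin n (f ∘ suc)         ≤⟨ +-monoˡ-≤ _ (0≤f zero) ⟩
  sumFin (suc n) f                ∎

-- Also for q = 0, where both sides are 0.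
÷?-≡-*-1÷? : ∀ p q → p ÷? q ≡ p * (1ℚ ÷? q)
÷?-≡-*-1÷? p q with q ≟ 0ℚ
... | yes _ = sym (*-zeroʳ p)
... | no  _ = cong (p *_) (sym (*-identityˡ _))

*-1÷?-inverseʳ : ∀ {q} → q ≢ 0ℚ → q * (1ℚ ÷? q) ≡ 1ℚ
*-1÷?-inverseʳ {q} q≢0 with q ≟ 0ℚ
... | yes q≡0  = contradiction q≡0 q≢0
... | no  q≢0′ = trans (cong (q *_) (*-identityˡ _)) (*-inverseʳ q {{≢-nonZero q≢0′}})

1÷?-pos : ∀ {q} → 0ℚ < q → 0ℚ < 1ℚ ÷? q
1÷?-pos {q} 0<q with q ≟ 0ℚ
... | yes q≡0 = contradiction q≡0 (0<⇒≢0 0<q)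
... | no  q≢0 = *-pos (positive⁻¹ 1ℚ) (positive⁻¹ 1/q {{1/pos⇒pos q {{positive 0<q}}}})
  where 1/q = (1/ q) {{≢-nonZero q≢0}}

0÷? : ∀ q → 0ℚ ÷? q ≡ 0ℚ
0÷? q = trans (÷?-≡-*-1÷? 0ℚ q) (*-zeroˡ (1ℚ ÷? q))

÷?-self : ∀ {q} → q ≢ 0ℚ → q ÷? q ≡ 1ℚ
÷?-self {q} q≢0 = trans (÷?-≡-*-1÷? q q) (*-1÷?-inverseʳ q≢0)

x*q≡p⇒p÷?q≡x : ∀ {p q x} → q ≢ 0ℚ → x * q ≡ p → p ÷? q ≡ x
x*q≡p⇒p÷?q≡x {p} {q} {x} q≢0 x*q≡p = begin-equality
  p ÷? q                ≡⟨ ÷?-≡-*-1÷? p q ⟩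
  p * (1ℚ ÷? q)         ≡⟨ cong (_* (1ℚ ÷? q)) x*q≡p ⟨
  x * q * (1ℚ ÷? q)     ≡⟨ *-assoc x q _ ⟩
  x * (q * (1ℚ ÷? q))   ≡⟨ cong (x *_) (*-1÷?-inverseʳ q≢0) ⟩
  x * 1ℚ                ≡⟨ *-identityʳ x ⟩
  x                     ∎

÷?-*-÷?-cancel : ∀ p {q} r → q ≢ 0ℚ → (q ÷? r) * (p ÷? q) ≡ p ÷? r
÷?-*-÷?-cancel p {q} r q≢0 = begin-equality
  (q ÷? r) * (p ÷? q)                    ≡⟨ cong₂ _*_ (÷?-≡-*-1÷? q r) (÷?-≡-*-1÷? p q) ⟩
  q * (1ℚ ÷? r) * (p * (1ℚ ÷? q))        ≡⟨ solve 4 (λ q r′ p q′ → q :* r′ :* (p :* q′)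
                                                             := p :* r′ :* (q :* q′))
                                                    refl q (1ℚ ÷? r) p (1ℚ ÷? q) ⟩
  p * (1ℚ ÷? r) * (q * (1ℚ ÷? q))        ≡⟨ cong (p * (1ℚ ÷? r) *_) (*-1÷?-inverseʳ q≢0) ⟩
  p * (1ℚ ÷? r) * 1ℚ                     ≡⟨ *-identityʳ _ ⟩
  p * (1ℚ ÷? r)                          ≡⟨ ÷?-≡-*-1÷? p r ⟨
  p ÷? r                                 ∎

*-÷?-assoc : ∀ p q r → (p * q) ÷? r ≡ p * (q ÷? r)
*-÷?-assoc p q r = begin-equality
  (p * q) ÷? r          ≡⟨ ÷?-≡-*-1÷? (p * q) r ⟩
  p * q * (1ℚ ÷? r)     ≡⟨ *-assoc p q _ ⟩
  p * (q * (1ℚ ÷? r))   ≡⟨ cong (p *_) (÷?-≡-*-1÷? q r) ⟨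
  p * (q ÷? r)          ∎

÷?-pos : ∀ {p q} → 0ℚ < p → 0ℚ < q → 0ℚ < p ÷? q
÷?-pos {p} {q} 0<p 0<q = begin-strict
  0ℚ              <⟨ *-pos 0<p (1÷?-pos 0<q) ⟩
  p * (1ℚ ÷? q)   ≡⟨ ÷?-≡-*-1÷? p q ⟨
  p ÷? q          ∎

÷?-monoˡ-≤ : ∀ {p q r} → 0ℚ < r → p ≤ q → p ÷? r ≤ q ÷? r
÷?-monoˡ-≤ {p} {q} {r} 0<r p≤q = begin
  p ÷? r          ≡⟨ ÷?-≡-*-1÷? p r ⟩
  p * (1ℚ ÷? r)   ≤⟨ *-monoʳ-≤-nonNeg (1ℚ ÷? r) {{nonNegative (<⇒≤ (1÷?-pos 0<r))}} p≤q ⟩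
  q * (1ℚ ÷? r)   ≡⟨ ÷?-≡-*-1÷? q r ⟨
  q ÷? r          ∎

1≤p*q⇒1÷?p≤q : ∀ {p q} → 0ℚ < p → 1ℚ ≤ p * q → 1ℚ ÷? p ≤ q
1≤p*q⇒1÷?p≤q {p} {q} 0<p 1≤p*q = begin
  1ℚ ÷? p         ≤⟨ ÷?-monoˡ-≤ 0<p 1≤p*q ⟩
  (p * q) ÷? p    ≡⟨ x*q≡p⇒p÷?q≡x (0<⇒≢0 0<p) (*-comm q p) ⟩
  q               ∎

sumFin-÷? : ∀ n (f : Fin n → ℚ) c → sumFin n (λ i → f i ÷? c) ≡ sumFin n f ÷? c
sumFin-÷? n f c = begin-equality
  sumFin n (λ i → f i ÷? c)          ≡⟨ sumFin-cong n (λ i → ÷?-≡-*-1÷? (f i) c) ⟩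
  sumFin n (λ i → f i * (1ℚ ÷? c))   ≡⟨ *-distribʳ-sumFin n (1ℚ ÷? c) f ⟩
  sumFin n f * (1ℚ ÷? c)             ≡⟨ ÷?-≡-*-1÷? (sumFin n f) c ⟨
  sumFin n f ÷? c                    ∎

^-nonNeg : ∀ {x} → 0ℚ ≤ x → ∀ k → 0ℚ ≤ x ^ k
^-nonNeg 0≤x zero    = 0≤1
^-nonNeg 0≤x (suc k) = *-nonNeg 0≤x (^-nonNeg 0≤x k)

1≤^ : ∀ {x} → 1ℚ ≤ x → ∀ k → 1ℚ ≤ x ^ k
1≤^ 1≤x zero    = ≤-refl
1≤^ {x} 1≤x (suc k) = begin
  1ℚ          ≤⟨ 1≤x ⟩
  x           ≡⟨ *-identityʳ x ⟨
  x * 1ℚ      ≤⟨ *-monoˡ-≤-nonNeg x {{nonNegative (≤-trans 0≤1 1≤x)}} (1≤^ 1≤x k) ⟩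
  x * x ^ k   ∎

^-≤1 : ∀ {x} → 0ℚ ≤ x → x ≤ 1ℚ → ∀ k → x ^ k ≤ 1ℚ
^-≤1 0≤x x≤1 zero    = ≤-refl
^-≤1 {x} 0≤x x≤1 (suc k) = begin
  x * x ^ k   ≤⟨ *-monoˡ-≤-nonNeg x {{nonNegative 0≤x}} (^-≤1 0≤x x≤1 k) ⟩
  x * 1ℚ      ≡⟨ *-identityʳ x ⟩
  x           ≤⟨ x≤1 ⟩
  1ℚ          ∎

fromℤ-suc : ∀ k → fromℤ (+ suc k) ≡ 1ℚ + fromℤ (+ k)
fromℤ-suc k = sym (trans (/-cong (cong (ℤ._+_ (+ 1)) (ℤ.*-identityʳ (+ k))) refl) (normalize-coprime _))

fromℤ-mono-suc : ∀ k → fromℤ (+ k) ≤ fromℤ (+ suc k)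
fromℤ-mono-suc k = begin
  fromℤ (+ k)         ≡⟨ +-identityˡ (fromℤ (+ k)) ⟨
  0ℚ + fromℤ (+ k)    ≤⟨ +-monoˡ-≤ (fromℤ (+ k)) 0≤1 ⟩
  1ℚ + fromℤ (+ k)    ≡⟨ fromℤ-suc k ⟨
  fromℤ (+ suc k)     ∎

≤-fromℤ∣↥∣ : ∀ q → q ≤ fromℤ (+ ℤ.∣ ↥ q ∣)
≤-fromℤ∣↥∣ (mkℚ (+ a)     _ _) = *≤* (ℤ.*-monoˡ-≤-nonNeg (+ a) (ℤ.+≤+ (s≤s z≤n)))
≤-fromℤ∣↥∣ (mkℚ -[1+ a ]  _ _) = *≤* ℤ.-≤+

bernoulli : ∀ {x} → 0ℚ ≤ x → x ≤ 1ℚ → ∀ k →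
            (1ℚ - x) ^ k * (1ℚ + fromℤ (+ k) * x) ≤ 1ℚ
bernoulli {x} 0≤x x≤1 zero =
  ≤-reflexive (solve 1 (λ x → con 1ℚ :* (con 1ℚ :+ con 0ℚ :* x) := con 1ℚ) refl x)
bernoulli {x} 0≤x x≤1 (suc k) = begin
  (1ℚ - x) ^ suc k * (1ℚ + fromℤ (+ suc k) * x)
    ≡⟨ cong (λ c → (1ℚ - x) ^ suc k * (1ℚ + c * x)) (fromℤ-suc k) ⟩
  (1ℚ - x) * r^k * (1ℚ + (1ℚ + κ) * x)
    ≡⟨ solve 3 (λ x r κ → (con 1ℚ :- x) :* r :* (con 1ℚ :+ (con 1ℚ :+ κ) :* x)
                       := r :* (con 1ℚ :+ κ :* x) :- r :* (x :* x :* (con 1ℚ :+ κ)))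
               refl x r^k κ ⟩
  r^k * (1ℚ + κ * x) - r^k * (x * x * (1ℚ + κ))
    ≤⟨ p-q≤p _ (*-nonNeg (^-nonNeg (p≤q⇒0≤q-p x≤1) k) (*-nonNeg (*-nonNeg 0≤x 0≤x) 0≤1+κ)) ⟩
  r^k * (1ℚ + κ * x)
    ≤⟨ bernoulli 0≤x x≤1 k ⟩
  1ℚ
    ∎
  where
  r^k = (1ℚ - x) ^ k
  κ   = fromℤ (+ k)
  0≤1+κ : 0ℚ ≤ 1ℚ + κ
  0≤1+κ = ≤-trans (nonNegative⁻¹ (fromℤ (+ suc k))) (≤-reflexive (fromℤ-suc k))

p≤1⇒p*½≤1 : ∀ {p} → p ≤ 1ℚ → p * ½ ≤ 1ℚ
p≤1⇒p*½≤1 p≤1 = ≤-trans (*-monoʳ-≤-nonNeg ½ p≤1) (≤ᵇ⇒≤ _)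

-- 398 = 2 · 199: once λ′ p ≥ 1, γ p/2 ≥ 199 and Bernoulli gives (1 - p/2)^γ ≤ 1/200.
γ : ℚ → ℕ
γ λ′ = suc ℤ.∣ ↥ (+ 398 / 1 * λ′) ∣

398λ′≤γ : ∀ λ′ → + 398 / 1 * λ′ ≤ fromℤ (+ γ λ′)
398λ′≤γ λ′ = ≤-trans (≤-fromℤ∣↥∣ (+ 398 / 1 * λ′)) (fromℤ-mono-suc _)

2*[1-p*½]^γ≤1/100 : ∀ {λ′ p} → 0ℚ ≤ p → p ≤ 1ℚ → 1ℚ ≤ λ′ * p →
                    (+ 2 / 1) * (1ℚ - p * ½) ^ γ λ′ ≤ + 1 / 100
2*[1-p*½]^γ≤1/100 {λ′} {p} 0≤p p≤1 1≤λ′p = begin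
  (+ 2 / 1) * u                    ≡⟨ solve 1 (λ u → con (+ 2 / 1) :* u
                                                  := u :* con (+ 200 / 1) :* con (+ 1 / 100)) refl u ⟩
  u * (+ 200 / 1) * (+ 1 / 100)    ≤⟨ *-monoʳ-≤-nonNeg (+ 1 / 100) u*200≤1 ⟩
  1ℚ * (+ 1 / 100)                 ≡⟨ *-identityˡ _ ⟩
  + 1 / 100                        ∎
  where
  x = p * ½
  u = (1ℚ - x) ^ γ λ′
  0≤x : 0ℚ ≤ x
  0≤x = *-nonNeg 0≤p (≤ᵇ⇒≤ _)
  x≤1 : x ≤ 1ℚ
  x≤1 = p≤1⇒p*½≤1 p≤1
  0≤u : 0ℚ ≤ u
  0≤u = ^-nonNeg (p≤q⇒0≤q-p x≤1) (γ λ′)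
  199≤γx : + 199 / 1 ≤ fromℤ (+ γ λ′) * x
  199≤γx = begin
    + 398 / 1 * ½ * 1ℚ          ≤⟨ *-monoˡ-≤-nonNeg (+ 398 / 1 * ½) 1≤λ′p ⟩
    + 398 / 1 * ½ * (λ′ * p)    ≡⟨ solve 2 (λ λ′ p → con (+ 398 / 1) :* con ½ :* (λ′ :* p)
                                                  := con (+ 398 / 1) :* λ′ :* (p :* con ½)) refl λ′ p ⟩
    + 398 / 1 * λ′ * x          ≤⟨ *-monoʳ-≤-nonNeg x {{nonNegative 0≤x}} (398λ′≤γ λ′) ⟩
    fromℤ (+ γ λ′) * x          ∎
  u*200≤1 : u * (+ 200 / 1) ≤ 1ℚ
  u*200≤1 = begin
    u * (+ 200 / 1)                ≤⟨ *-monoˡ-≤-nonNeg u {{nonNegative 0≤u}} (+-monoʳ-≤ 1ℚ 199≤γx) ⟩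
    u * (1ℚ + fromℤ (+ γ λ′) * x)  ≤⟨ bernoulli 0≤x x≤1 (γ λ′) ⟩
    1ℚ                             ∎

-- R m N stands for the probability of at least N successes in m independent trials
-- of success probability p.  The bound is Markov's inequality for 2^(-X), X the
-- number of successes, whose expectation is (1 - p/2)^m.
module BinomialTail
  (p : ℚ) (0≤p : 0ℚ ≤ p) (p≤1 : p ≤ 1ℚ) (R : ℕ → ℕ → ℚ)
  (R-zero : ∀ m → R m 0 ≡ 1ℚ)
  (R-nonNeg : ∀ N → 0ℚ ≤ R 0 (suc N))
  (R-suc : ∀ m N → R (suc m) (suc N) ≡ (1ℚ - p) * R m (suc N) + p * R m N)
  where

  r : ℚ
  r = 1ℚ - p * ½

  0≤r : 0ℚ ≤ r
  0≤r = p≤q⇒0≤q-p (p≤1⇒p*½≤1 p≤1)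

  tail-bound : ∀ m N → 1ℚ - (+ 2 / 1) ^ N * r ^ m ≤ R m N
  tail-bound m zero = begin
    1ℚ - 1ℚ * r ^ m   ≤⟨ p-q≤p 1ℚ (*-nonNeg 0≤1 (^-nonNeg 0≤r m)) ⟩
    1ℚ                ≡⟨ R-zero m ⟨
    R m 0             ∎
  tail-bound zero (suc N) = begin
    1ℚ - 2ᴺ⁺¹ * 1ℚ           ≤⟨ +-monoˡ-≤ (- (2ᴺ⁺¹ * 1ℚ)) 1≤2ᴺ⁺¹*1 ⟩
    2ᴺ⁺¹ * 1ℚ - 2ᴺ⁺¹ * 1ℚ    ≡⟨ +-inverseʳ (2ᴺ⁺¹ * 1ℚ) ⟩
    0ℚ                       ≤⟨ R-nonNeg N ⟩
    R 0 (suc N)              ∎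
    where
    2ᴺ⁺¹ = (+ 2 / 1) ^ suc N
    1≤2ᴺ⁺¹*1 : 1ℚ ≤ 2ᴺ⁺¹ * 1ℚ
    1≤2ᴺ⁺¹*1 = ≤-trans (1≤^ {+ 2 / 1} (≤ᵇ⇒≤ _) (suc N))
                       (≤-reflexive (sym (*-identityʳ 2ᴺ⁺¹)))
  tail-bound (suc m) (suc N) = begin
    1ℚ - (+ 2 / 1) ^ suc N * r ^ suc m
      ≡⟨ solve 3 (λ p 2ᴺ rᵐ → con 1ℚ :- con (+ 2 / 1) :* 2ᴺ :* ((con 1ℚ :- p :* con ½) :* rᵐ)
                   := (con 1ℚ :- p) :* (con 1ℚ :- con (+ 2 / 1) :* 2ᴺ :* rᵐ)
                      :+ p :* (con 1ℚ :- 2ᴺ :* rᵐ))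
               refl p ((+ 2 / 1) ^ N) (r ^ m) ⟩
    (1ℚ - p) * (1ℚ - (+ 2 / 1) ^ suc N * r ^ m) + p * (1ℚ - (+ 2 / 1) ^ N * r ^ m)
      ≤⟨ +-mono-≤ (*-monoˡ-≤-nonNeg (1ℚ - p) {{nonNegative (p≤q⇒0≤q-p p≤1)}} (tail-bound m (suc N)))
                  (*-monoˡ-≤-nonNeg p {{nonNegative 0≤p}} (tail-bound m N)) ⟩
    (1ℚ - p) * R m (suc N) + p * R m N
      ≡⟨ R-suc m N ⟨
    R (suc m) (suc N)
      ∎

  tail-bound-γ : ∀ {λ′} → 1ℚ ≤ λ′ * p → ∀ N → + 99 / 100 ≤ R (γ λ′ ℕ.* N) N
  tail-bound-γ {λ′} _ zero = ≤-trans (≤ᵇ⇒≤ _) (≤-reflexive (sym (R-zero (γ λ′ ℕ.* 0))))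
  tail-bound-γ {λ′} 1≤λ′p (suc N) = begin
    1ℚ - + 1 / 100                                 ≤⟨ +-monoʳ-≤ 1ℚ (neg-antimono-≤ vᴺ⁺¹≤1/100) ⟩
    1ℚ - v ^ suc N                                 ≡⟨ cong (_-_ 1ℚ) vᴺ⁺¹≡ ⟩
    1ℚ - (+ 2 / 1) ^ suc N * r ^ (γ λ′ ℕ.* suc N)  ≤⟨ tail-bound (γ λ′ ℕ.* suc N) (suc N) ⟩
    R (γ λ′ ℕ.* suc N) (suc N)                     ∎
    where
    v = (+ 2 / 1) * r ^ γ λ′
    0≤v : 0ℚ ≤ v
    0≤v = *-nonNeg {+ 2 / 1} (≤ᵇ⇒≤ _) (^-nonNeg 0≤r (γ λ′))
    v≤1/100 : v ≤ + 1 / 100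
    v≤1/100 = 2*[1-p*½]^γ≤1/100 {λ′} 0≤p p≤1 1≤λ′p
    vᴺ⁺¹≤1/100 : v ^ suc N ≤ + 1 / 100
    vᴺ⁺¹≤1/100 = begin
      v * v ^ N    ≤⟨ *-monoˡ-≤-nonNeg v {{nonNegative 0≤v}}
                          (^-≤1 0≤v (≤-trans v≤1/100 (≤ᵇ⇒≤ _)) N) ⟩
      v * 1ℚ       ≡⟨ *-identityʳ v ⟩
      v            ≤⟨ v≤1/100 ⟩
      + 1 / 100    ∎
    vᴺ⁺¹≡ : v ^ suc N ≡ (+ 2 / 1) ^ suc N * r ^ (γ λ′ ℕ.* suc N)
    vᴺ⁺¹≡ = trans (^-distrib-* (+ 2 / 1) (r ^ γ λ′) (suc N))
                  (cong ((+ 2 / 1) ^ suc N *_) (^-assocʳ r (γ λ′) (suc N)))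

atLeast-suc-just : ∀ {n} N (y : Fin n) l → atLeast (suc N) (just y ∷ l) ≡ atLeast N l
atLeast-suc-just zero    y l = refl
atLeast-suc-just (suc N) y l = refl

module LazySamplingAnalysis
  {n s : ℕ} (site : Fin n → Fin s) (d : Fin n → ℚ) (D̃ : Fin s → ℚ) (λ′ : ℚ)
  (0≤d : ∀ x → 0ℚ ≤ d x)
  (D≤D̃ : ∀ i → LazySampling.Dsite site d D̃ i ≤ D̃ i)
  (D̃≤λ′D : ∀ i → D̃ i ≤ λ′ * LazySampling.Dsite site d D̃ i)
  (0<D : 0ℚ < LazySampling.Dtot site d D̃)
  where

  open LazySampling site d D̃

  siteWeight : Fin s → Fin n → ℚ
  siteWeight i x = if isYes (site x Fin.≟ i) then d x else 0ℚ

  0≤siteWeight : ∀ i x → 0ℚ ≤ siteWeight i x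
  0≤siteWeight i x with isYes (site x Fin.≟ i)
  ... | true  = 0≤d x
  ... | false = ≤-refl

  0≤Dsite : ∀ i → 0ℚ ≤ Dsite i
  0≤Dsite i = sumFin-nonNeg n (0≤siteWeight i)

  d≤Dsite : ∀ y → d y ≤ Dsite (site y)
  d≤Dsite y = begin
    d y                     ≡⟨ cong (if_then d y else 0ℚ) site-y≟site-y ⟨
    siteWeight (site y) y   ≤⟨ term≤sumFin n (0≤siteWeight (site y)) y ⟩
    Dsite (site y)          ∎
    where
    site-y≟site-y : isYes (site y Fin.≟ site y) ≡ true
    site-y≟site-y = trans (isYes≗does _) (dec-true (site y Fin.≟ site y) refl)

  Dtot≡sumFin-d : Dtot ≡ sumFin n d
  Dtot≡sumFin-d = begin-equality
    sumFin s (λ i → sumFin n (siteWeight i))   ≡⟨ sumFin-comm s n siteWeight ⟩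
    sumFin n (λ x → sumFin s (λ i → siteWeight i x))
      ≡⟨ sumFin-cong n (λ x → sumFin-cong s (λ i →
           cong (if_then d x else 0ℚ) (isYes≗does (site x Fin.≟ i)))) ⟩
    sumFin n (λ x → sumFin s (λ i → if does (site x Fin.≟ i) then d x else 0ℚ))
      ≡⟨ sumFin-cong n (λ x → sumFin-indicator s (site x) (d x)) ⟩
    sumFin n d                                 ∎

  Dtot≤D̃tot : Dtot ≤ D̃tot
  Dtot≤D̃tot = sumFin-mono-≤ s D≤D̃

  D̃tot≤λ′Dtot : D̃tot ≤ λ′ * Dtot
  D̃tot≤λ′Dtot = ≤-trans (sumFin-mono-≤ s D̃≤λ′D) (≤-reflexive (*-distribˡ-sumFin s λ′ Dsite))

  0<D̃tot : 0ℚ < D̃tot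
  0<D̃tot = <-≤-trans 0<D Dtot≤D̃tot

  D̃≡0⇒D≡0 : ∀ i → D̃ i ≡ 0ℚ → Dsite i ≡ 0ℚ
  D̃≡0⇒D≡0 i D̃ᵢ≡0 = ≤-antisym (≤-trans (D≤D̃ i) (≤-reflexive D̃ᵢ≡0)) (0≤Dsite i)

  pick-*-÷? : ∀ i a → (D̃ i ≡ 0ℚ → a ≡ 0ℚ) → pick i * (a ÷? D̃ i) ≡ a ÷? D̃tot
  pick-*-÷? i a D̃ᵢ≡0⇒a≡0 = by-cases (D̃ i ≟ 0ℚ)
    where
    -- not a with: that would also abstract the test inside _÷?_
    by-cases : Dec (D̃ i ≡ 0ℚ) → pick i * (a ÷? D̃ i) ≡ a ÷? D̃tot
    by-cases (no  D̃ᵢ≢0) = ÷?-*-÷?-cancel a D̃tot D̃ᵢ≢0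
    by-cases (yes D̃ᵢ≡0) rewrite D̃ᵢ≡0⇒a≡0 D̃ᵢ≡0 =
      trans (cong (pick i *_) (0÷? (D̃ i))) (trans (*-zeroʳ (pick i)) (sym (0÷? D̃tot)))

  prOut-just : ∀ y → prOut (just y) ≡ d y ÷? D̃tot
  prOut-just y = pick-*-÷? (site y) (d y) λ D̃≡0 →
    ≤-antisym (≤-trans (d≤Dsite y) (≤-reflexive (D̃≡0⇒D≡0 (site y) D̃≡0))) (0≤d y)

  prE≡Dtot÷?D̃tot : prE ≡ Dtot ÷? D̃tot
  prE≡Dtot÷?D̃tot = begin-equality
    sumFin n (λ y → prOut (just y))   ≡⟨ sumFin-cong n prOut-just ⟩
    sumFin n (λ y → d y ÷? D̃tot)      ≡⟨ sumFin-÷? n d D̃tot ⟩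
    sumFin n d ÷? D̃tot                ≡⟨ cong (_÷? D̃tot) Dtot≡sumFin-d ⟨
    Dtot ÷? D̃tot                      ∎

  0<prE : 0ℚ < prE
  0<prE = begin-strict
    0ℚ             <⟨ ÷?-pos 0<D 0<D̃tot ⟩
    Dtot ÷? D̃tot   ≡⟨ prE≡Dtot÷?D̃tot ⟨
    prE            ∎

  prE≤1 : prE ≤ 1ℚ
  prE≤1 = begin
    prE             ≡⟨ prE≡Dtot÷?D̃tot ⟩
    Dtot ÷? D̃tot    ≤⟨ ÷?-monoˡ-≤ 0<D̃tot Dtot≤D̃tot ⟩
    D̃tot ÷? D̃tot    ≡⟨ ÷?-self (0<⇒≢0 0<D̃tot) ⟩
    1ℚ              ∎

  1≤λ′*prE : 1ℚ ≤ λ′ * prE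
  1≤λ′*prE = begin
    1ℚ                     ≡⟨ ÷?-self (0<⇒≢0 0<D̃tot) ⟨
    D̃tot ÷? D̃tot           ≤⟨ ÷?-monoˡ-≤ 0<D̃tot D̃tot≤λ′Dtot ⟩
    (λ′ * Dtot) ÷? D̃tot    ≡⟨ *-÷?-assoc λ′ Dtot D̃tot ⟩
    λ′ * (Dtot ÷? D̃tot)    ≡⟨ cong (λ′ *_) prE≡Dtot÷?D̃tot ⟨
    λ′ * prE               ∎

  prCond≡d÷?Dtot : ∀ y → prCond y ≡ d y ÷? Dtot
  prCond≡d÷?Dtot y = x*q≡p⇒p÷?q≡x (0<⇒≢0 0<prE) (begin-equality
    d y ÷? Dtot * prE                 ≡⟨ cong (d y ÷? Dtot *_) prE≡Dtot÷?D̃tot ⟩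
    d y ÷? Dtot * (Dtot ÷? D̃tot)      ≡⟨ *-comm (d y ÷? Dtot) _ ⟩
    (Dtot ÷? D̃tot) * (d y ÷? Dtot)    ≡⟨ ÷?-*-÷?-cancel (d y) D̃tot (0<⇒≢0 0<D) ⟩
    d y ÷? D̃tot                       ≡⟨ prOut-just y ⟨
    prOut (just y)                    ∎)

  prOut-nothing+prE≡1 : prOut nothing + prE ≡ 1ℚ
  prOut-nothing+prE≡1 = begin-equality
    sumFin s (λ i → pick i * (1ℚ - rᵢ i)) + prE
      ≡⟨ cong (_+_ (prOut nothing)) (trans prE≡Dtot÷?D̃tot (sym (sumFin-÷? s Dsite D̃tot))) ⟩
    sumFin s (λ i → pick i * (1ℚ - rᵢ i)) + sumFin s (λ i → Dsite i ÷? D̃tot)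
      ≡⟨ sumFin-distrib-+ s _ _ ⟨
    sumFin s (λ i → pick i * (1ℚ - rᵢ i) + Dsite i ÷? D̃tot)
      ≡⟨ sumFin-cong s (λ i → cong (λ t → pick i * (1ℚ - rᵢ i) + t)
                                    (pick-*-÷? i (Dsite i) (D̃≡0⇒D≡0 i))) ⟨
    sumFin s (λ i → pick i * (1ℚ - rᵢ i) + pick i * rᵢ i)
      ≡⟨ sumFin-cong s (λ i → solve 2 (λ a r → a :* (con 1ℚ :- r) :+ a :* r := a) refl (pick i) (rᵢ i)) ⟩
    sumFin s pick
      ≡⟨ sumFin-÷? s D̃ D̃tot ⟩
    D̃tot ÷? D̃tot
      ≡⟨ ÷?-self (0<⇒≢0 0<D̃tot) ⟩
    1ℚ  ∎
    where
    rᵢ : Fin s → ℚ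
    rᵢ i = Dsite i ÷? D̃ i

  prOut-nothing : prOut nothing ≡ 1ℚ - prE
  prOut-nothing = begin-equality
    prOut nothing               ≡⟨ solve 2 (λ q p → q := q :+ p :- p) refl (prOut nothing) prE ⟩
    prOut nothing + prE - prE   ≡⟨ cong (_- prE) prOut-nothing+prE≡1 ⟩
    1ℚ - prE                    ∎

  runsProb-cong : ∀ m {P Q : List (Maybe (Fin n)) → Bool} → P ≗ Q → runsProb m P ≡ runsProb m Q
  runsProb-cong zero    P≗Q = cong (if_then 1ℚ else 0ℚ) (P≗Q [])
  runsProb-cong (suc m) P≗Q = cong₂ _+_
    (cong (prOut nothing *_) (runsProb-cong m (P≗Q ∘ (nothing ∷_))))
    (sumFin-cong n (λ y → cong (prOut (just y) *_) (runsProb-cong m (P≗Q ∘ (just y ∷_)))))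

  runsProb-suc : ∀ m {P Q : List (Maybe (Fin n)) → Bool} → (∀ y l → P (just y ∷ l) ≡ Q l) →
    runsProb (suc m) P ≡ (1ℚ - prE) * runsProb m (P ∘ (nothing ∷_)) + prE * runsProb m Q
  runsProb-suc m {P} {Q} P∘just≗Q =
    cong₂ _+_ (cong (_* runsProb m (P ∘ (nothing ∷_))) prOut-nothing) points
    where
    points : sumFin n (λ y → prOut (just y) * runsProb m (P ∘ (just y ∷_))) ≡ prE * runsProb m Q
    points = begin-equality
      sumFin n (λ y → prOut (just y) * runsProb m (P ∘ (just y ∷_)))
        ≡⟨ sumFin-cong n (λ y → cong (prOut (just y) *_) (runsProb-cong m (P∘just≗Q y))) ⟩
      sumFin n (λ y → prOut (just y) * runsProb m Q)
        ≡⟨ *-distribʳ-sumFin n (runsProb m Q) (λ y → prOut (just y)) ⟩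
      prE * runsProb m Q
        ∎

  runsProb-true : ∀ m → runsProb m (λ _ → true) ≡ 1ℚ
  runsProb-true zero    = refl
  runsProb-true (suc m) = begin-equality
    runsProb (suc m) (λ _ → true)       ≡⟨ runsProb-suc m {λ _ → true} (λ _ _ → refl) ⟩
    (1ℚ - prE) * runsProb m (λ _ → true) + prE * runsProb m (λ _ → true)
                                         ≡⟨ cong (λ t → (1ℚ - prE) * t + prE * t) (runsProb-true m) ⟩
    (1ℚ - prE) * 1ℚ + prE * 1ℚ           ≡⟨ solve 1 (λ p → (con 1ℚ :- p) :* con 1ℚ :+ p :* con 1ℚ
                                                         := con 1ℚ) refl prE ⟩
    1ℚ                                   ∎

  runsProb-atLeast-suc : ∀ m N → runsProb (suc m) (atLeast (suc N)) ≡
    (1ℚ - prE) * runsProb m (atLeast (suc N)) + prE * runsProb m (atLeast N)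
  runsProb-atLeast-suc m N = runsProb-suc m {atLeast (suc N)} (atLeast-suc-just N)

  open BinomialTail prE (<⇒≤ 0<prE) prE≤1 (λ m N → runsProb m (atLeast N))
    runsProb-true (λ _ → ≤-refl) runsProb-atLeast-suc
    public using (tail-bound-γ)

lemma2p11 : (λ′ : ℚ) → 1ℚ < λ′ →
    Σ[ γ ∈ ℕ ] (1 ℕ.≤ γ ×
      ((n s : ℕ) (site : Fin n → Fin s) (d : Fin n → ℚ) (D̃ : Fin s → ℚ) →
        ((x : Fin n) → 0ℚ ≤ d x) →
        ((i : Fin s) → LazySampling.Dsite site d D̃ i ≤ D̃ i) →
        ((i : Fin s) → D̃ i ≤ λ′ * LazySampling.Dsite site d D̃ i) →
        0ℚ < LazySampling.Dtot site d D̃ →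
        ((1ℚ ÷? λ′) ≤ LazySampling.prE site d D̃)
        × ((y : Fin n) → LazySampling.prCond site d D̃ y ≡ d y ÷? LazySampling.Dtot site d D̃)
        × ((N : ℕ) → (+ 99 / 100) ≤ LazySampling.runsProb site d D̃ (γ ℕ.* N) (atLeast N))))
lemma2p11 λ′ 1<λ′ = γ λ′ , s≤s z≤n , λ n s site d D̃ 0≤d D≤D̃ D̃≤λ′D 0<D →
  let open LazySamplingAnalysis site d D̃ λ′ 0≤d D≤D̃ D̃≤λ′D 0<D in
  1≤p*q⇒1÷?p≤q (<-trans (positive⁻¹ 1ℚ) 1<λ′) 1≤λ′*prE ,
  prCond≡d÷?Dtot ,
  tail-bound-γ {λ′} 1≤λ′*prE
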